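{- Let $n\ge 4$ and $t\in[n-1]$ be integers, and let $S$ be a weak $(2n-2t-1)$-resolving set of $K_n\times K_n$, with $\overline{S}=V\setminus S$. For all distinct $i,i'\in[n]$: if there exists $j\in[n]$ with $(i,j)\in\overline{S}$ and $(i',j)\in\overline{S}$, then $|(L_i\cup L_{i'})\cap\overline{S}|\le 2t+1$; otherwise $|(L_i\cup L_{i'})\cap\overline{S}|\le 2t+2$.
   Context: $K_n\times K_n$ is the direct product of two complete graphs: vertex set $V=[n]\times[n]$ with $[n]=\{1,\dots,n\}$, where $(i,j)$ and $(i',j')$ are adjacent iff $i\ne i'$ and $j\ne j'$. For $i\in[n]$, $L_i=\{(i,j):j\in[n]\}$. With $d$ the shortest-path distance, for $S\subseteq V$ and vertices $x,y,z$: $\Delta_z(x,y)=|d(x,z)-d(y,z)|$ and $\Delta_S(x,y)=\sum_{z\in S}\Delta_z(x,y)$. A set $S$ of vertices is a weak $k$-resolving set if $\Delta_S(x,y)\ge k$ for all distinct vertices $x,y$. -}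

module Defs where

open import Data.Nat using (ℕ; zero; suc; _+_; _*_; _∸_; _≤_)
open import Data.Bool using (Bool; true; false; _∧_; _∨_; not; if_then_else_)
open import Data.Fin using (Fin)
open import Data.Fin.Properties using () renaming (_≟_ to _≟F_)
open import Data.Product using (_×_; _,_; proj₁; proj₂)
open import Data.List using (List; allFin; cartesianProduct; map)
open import Data.Nat.ListAction using (sum)
open import Data.Bool.ListAction using (any)
open import Relation.Nullary using (¬_; does)
open import Relation.Binary.PropositionalEquality using (_≡_)

Vtx : ℕ → Set
Vtx n = Fin n × Fin n

eqF : {n : ℕ} → Fin n → Fin n → Bool
eqF a b = does (a ≟F b)

eqV : {n : ℕ} → Vtx n → Vtx n → Bool
eqV (i , j) (i' , j') = eqF i i' ∧ eqF j j'

adj : {n : ℕ} → Vtx n → Vtx n → Bool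
adj (i , j) (i' , j') = not (eqF i i') ∧ not (eqF j j')

vertices : (n : ℕ) → List (Vtx n)
vertices n = cartesianProduct (allFin n) (allFin n)

ball : {n : ℕ} → ℕ → Vtx n → Vtx n → Bool
ball {n} zero x y = eqV x y
ball {n} (suc k) x y = ball k x y ∨ any (λ z → ball k x z ∧ adj z y) (vertices n)

-- Least k in [m, m + fuel] with ball k x y; returns m + fuel if none.
search : {n : ℕ} → Vtx n → Vtx n → ℕ → ℕ → ℕ
search x y m zero = m
search x y m (suc fuel) = if ball m x y then m else search x y (suc m) fuel

-- Shortest-path distance d(x,y): least k with a walk of length ≤ k from x to y.
-- (Any shortest path has length < n*n, so the search bound n*n suffices whenever
--  y is reachable; the graph is connected for n ≥ 3.)
dist : {n : ℕ} → Vtx n → Vtx n → ℕ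
dist {n} x y = search x y 0 (n * n)

absDiff : ℕ → ℕ → ℕ
absDiff a b = (a ∸ b) + (b ∸ a)

Δz : {n : ℕ} → Vtx n → Vtx n → Vtx n → ℕ
Δz z x y = absDiff (dist x z) (dist y z)

VSet : ℕ → Set
VSet n = Vtx n → Bool

ΔS : {n : ℕ} → VSet n → Vtx n → Vtx n → ℕ
ΔS {n} S x y = sum (map (λ z → if S z then Δz z x y else 0) (vertices n))

WeakResolving : {n : ℕ} → ℕ → VSet n → Set
WeakResolving {n} k S = (x y : Vtx n) → ¬ (x ≡ y) → k ≤ ΔS S x y

compl : {n : ℕ} → VSet n → VSet n
compl S v = not (S v)

card : {n : ℕ} → VSet n → ℕ
card {n} A = sum (map (λ v → if A v then 1 else 0) (vertices n))

L : {n : ℕ} → Fin n → VSet n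
L i v = eqF (proj₁ v) i

_∪_ : {n : ℕ} → VSet n → VSet n → VSet n
(A ∪ B) v = A v ∨ B v

_∩_ : {n : ℕ} → VSet n → VSet n → VSet n
(A ∩ B) v = A v ∧ B v

_∈_ : {n : ℕ} → Vtx n → VSet n → Set
v ∈ A = A v ≡ true

-- Put x = (i , j) and y = (i' , j). For n ≥ 3 the graph has diameter 2, and for u ≠ z whether
-- d(u, z) is 1 or 2 depends only on adjacency. So a vertex z outside L_i ∪ L_i' sees x and y at
-- the same distance, any other z ≠ x, y sees them at distances in {1, 2}, and x, y themselves
-- contribute 2. Hence
--   2n - 2t - 1 ≤ Δ_S(x, y) ≤ |(L_i ∪ L_i') ∩ S| + [x ∈ S] + [y ∈ S],
-- and as |L_i ∪ L_i'| ≤ 2n, every column j gives |(L_i ∪ L_i') ∩ S̄| ≤ 2t + 1 + [x ∈ S] + [y ∈ S].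
-- A column with x, y ∉ S gives 2t + 1, a column with x ∉ S or y ∉ S gives 2t + 2, and if no
-- column of the second kind exists then (L_i ∪ L_i') ∩ S̄ is empty.
module Submission where

open import Defs
open import Data.Bool using (Bool; true; false; _∧_; _∨_; not; if_then_else_)
open import Data.Bool.Properties using (∨-zeroʳ; T-≡; T-∧) renaming (_≟_ to _≟B_)
open import Data.Bool.ListAction using (any)
open import Data.Empty using (⊥-elim)
open import Data.Fin using (Fin; zero; suc)
open import Data.Fin.Properties using (any?) renaming (_≟_ to _≟F_)
open import Data.List using (List; []; _∷_; _++_; allFin; tabulate; cartesianProduct; map; length)
open import Data.List.Membership.Propositional using (lose) renaming (_∈_ to _∈ᴸ_)
open import Data.List.Membership.Propositional.Properties using (∈-cartesianProduct⁺; ∈-allFin)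
open import Data.List.Properties using (map-++; map-∘; map-cong; map-tabulate; length-tabulate)
open import Data.List.Relation.Unary.Any.Properties using (any⁺)
open import Data.Nat using (ℕ; zero; suc; _+_; _*_; _∸_; _≤_; z≤n; s≤s)
open import Data.Nat.ListAction using (sum)
open import Data.Nat.ListAction.Properties using (sum-++)
open import Data.Nat.Properties
  using (≤-refl; ≤-reflexive; ≤-trans; ≤-total; <⇒≤; module ≤-Reasoning; +-assoc; +-comm; +-identityʳ;
         +-mono-≤; +-monoˡ-≤; +-monoʳ-≤; *-monoʳ-<; n∸n≡0; m∸n≤m; m≤n⇒m∸n≡0; ∸-+-assoc; +-∸-comm;
         m+n≤o⇒m≤o∸n; m∸[m∸n]≡n; +-commutativeSemigroup)
open import Algebra.Properties.CommutativeSemigroup +-commutativeSemigroup using (interchange)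
open import Data.Product using (Σ; _×_; _,_; proj₁; proj₂)
open import Data.Sum using (_⊎_; inj₁; inj₂)
open import Function using (_∘_; id)
open import Function.Bundles using (Equivalence)
open import Relation.Nullary using (¬_; yes; no)
open import Relation.Nullary.Decidable using (dec-true; does-≡; map′; _⊎-dec_)
open import Relation.Binary.PropositionalEquality
  using (_≡_; refl; sym; trans; cong; cong₂; subst; module ≡-Reasoning)

indicator : Bool → ℕ
indicator b = if b then 1 else 0

indicator-≤1 : (b : Bool) → indicator b ≤ 1
indicator-≤1 true  = ≤-refl
indicator-≤1 false = z≤n

indicator-not : {b : Bool} → not b ≡ true → indicator b ≡ 0
indicator-not {false} _ = refl

indicator+indicator-≤1 : {b b' : Bool} → not b ≡ true ⊎ not b' ≡ true → indicator b + indicator b' ≤ 1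
indicator+indicator-≤1 {false} {b'}    _ = indicator-≤1 b'
indicator+indicator-≤1 {true}  {false} _ = ≤-refl
indicator+indicator-≤1 {true}  {true}  (inj₁ ())
indicator+indicator-≤1 {true}  {true}  (inj₂ ())

absDiff-≤ : {a b k : ℕ} → a ≤ k → b ≤ k → absDiff a b ≤ k
absDiff-≤ {a} {b} {k} a≤k b≤k with ≤-total a b
... | inj₁ a≤b = begin
  (a ∸ b) + (b ∸ a) ≡⟨ cong (_+ (b ∸ a)) (m≤n⇒m∸n≡0 a≤b) ⟩
  b ∸ a             ≤⟨ m∸n≤m b a ⟩
  b                 ≤⟨ b≤k ⟩
  k                 ∎
  where open ≤-Reasoning
... | inj₂ b≤a = begin
  (a ∸ b) + (b ∸ a) ≡⟨ cong ((a ∸ b) +_) (m≤n⇒m∸n≡0 b≤a) ⟩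
  (a ∸ b) + 0       ≡⟨ +-identityʳ (a ∸ b) ⟩
  a ∸ b             ≤⟨ m∸n≤m a b ⟩
  a                 ≤⟨ a≤k ⟩
  k                 ∎
  where open ≤-Reasoning

absDiff-self : (a : ℕ) → absDiff a a ≡ 0
absDiff-self a = cong₂ _+_ (n∸n≡0 a) (n∸n≡0 a)

m+[n∸o]≤n+p⇒m≤o+p : ∀ m {n o} p → m + (n ∸ o) ≤ n + p → o ≤ n → m ≤ o + p
m+[n∸o]≤n+p⇒m≤o+p m {n} {o} p le o≤n = begin
  m                 ≤⟨ m+n≤o⇒m≤o∸n m le ⟩
  (n + p) ∸ (n ∸ o) ≡⟨ +-∸-comm p (m∸n≤m n o) ⟩
  n ∸ (n ∸ o) + p   ≡⟨ cong (_+ p) (m∸[m∸n]≡n o≤n) ⟩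
  o + p             ∎
  where open ≤-Reasoning

eqF-refl : {n : ℕ} (a : Fin n) → eqF a a ≡ true
eqF-refl a = dec-true (a ≟F a) refl

eqF-sym : {n : ℕ} (a b : Fin n) → eqF a b ≡ eqF b a
eqF-sym a b = does-≡ (a ≟F b) (map′ sym sym (b ≟F a))

eqF⇒≡ : {n : ℕ} {a b : Fin n} → eqF a b ≡ true → a ≡ b
eqF⇒≡ {a = a} {b} e with a ≟F b
eqF⇒≡ _  | yes a≡b = a≡b
eqF⇒≡ () | no _

eqV-refl : {n : ℕ} (x : Vtx n) → eqV x x ≡ true
eqV-refl (a , b) = cong₂ _∧_ (eqF-refl a) (eqF-refl b)

eqV⇒≡ : {n : ℕ} {x y : Vtx n} → eqV x y ≡ true → x ≡ y
eqV⇒≡ e with Equivalence.to T-∧ (Equivalence.from T-≡ e)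
... | a≡c , b≡d = cong₂ _,_ (eqF⇒≡ (Equivalence.to T-≡ a≡c)) (eqF⇒≡ (Equivalence.to T-≡ b≡d))

any-witness : {A : Set} (p : A → Bool) {xs : List A} {x : A} → x ∈ᴸ xs → p x ≡ true → any p xs ≡ true
any-witness p x∈xs px = Equivalence.to T-≡ (any⁺ p (lose x∈xs (Equivalence.from T-≡ px)))

any-none : {A : Set} (p : A → Bool) (xs : List A) → (∀ x → p x ≡ false) → any p xs ≡ false
any-none p []       _    = refl
any-none p (x ∷ xs) none rewrite none x = any-none p xs none

sum-map-mono : {A : Set} {f g : A → ℕ} → (∀ x → f x ≤ g x) → (xs : List A) → sum (map f xs) ≤ sum (map g xs)
sum-map-mono f≤g []       = z≤n
sum-map-mono f≤g (x ∷ xs) = +-mono-≤ (f≤g x) (sum-map-mono f≤g xs)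

sum-map-+ : {A : Set} (f g : A → ℕ) (xs : List A) →
  sum (map (λ x → f x + g x) xs) ≡ sum (map f xs) + sum (map g xs)
sum-map-+ f g []       = refl
sum-map-+ f g (x ∷ xs) =
  trans (cong (f x + g x +_) (sum-map-+ f g xs)) (interchange (f x) (g x) (sum (map f xs)) (sum (map g xs)))

sum-map-zero : {A : Set} (xs : List A) → sum (map (λ _ → 0) xs) ≡ 0
sum-map-zero []       = refl
sum-map-zero (_ ∷ xs) = sum-map-zero xs

sum-map-one : {A : Set} (xs : List A) → sum (map (λ _ → 1) xs) ≡ length xs
sum-map-one []       = refl
sum-map-one (_ ∷ xs) = cong suc (sum-map-one xs)

sum-cartesianProduct : {A B : Set} (f : A × B → ℕ) (as : List A) (bs : List B) →
  sum (map f (cartesianProduct as bs)) ≡ sum (map (λ a → sum (map (λ b → f (a , b)) bs)) as)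
sum-cartesianProduct f []       bs = refl
sum-cartesianProduct f (a ∷ as) bs = begin
  sum (map f (map (a ,_) bs ++ cartesianProduct as bs))
    ≡⟨ cong sum (map-++ f (map (a ,_) bs) (cartesianProduct as bs)) ⟩
  sum (map f (map (a ,_) bs) ++ map f (cartesianProduct as bs))
    ≡⟨ sum-++ (map f (map (a ,_) bs)) _ ⟩
  sum (map f (map (a ,_) bs)) + sum (map f (cartesianProduct as bs))
    ≡⟨ cong₂ _+_ (cong sum (sym (map-∘ bs))) (sum-cartesianProduct f as bs) ⟩
  sum (map (λ b → f (a , b)) bs) + sum (map (λ a → sum (map (λ b → f (a , b)) bs)) as)
    ∎
  where open ≡-Reasoning

map-tabulate-suc : {A : Set} {n : ℕ} (g : Fin (suc n) → A) → map g (tabulate suc) ≡ map (g ∘ suc) (allFin n)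
map-tabulate-suc g = trans (map-tabulate suc g) (sym (map-tabulate id (g ∘ suc)))

sum-allFin-pointMass : {n : ℕ} (q : Fin n) (g : Fin n → ℕ) →
  sum (map (λ b → if eqF q b then g b else 0) (allFin n)) ≡ g q
sum-allFin-pointMass {suc n} zero g
  rewrite map-tabulate-suc (λ b → if eqF zero b then g b else 0) | sum-map-zero (allFin n) = +-identityʳ (g zero)
sum-allFin-pointMass {suc n} (suc q) g
  rewrite map-tabulate-suc (λ b → if eqF (suc q) b then g b else 0) = sum-allFin-pointMass q (g ∘ suc)

sum-vertices-pointMass : {n : ℕ} (x : Vtx n) (f : Vtx n → ℕ) →
  sum (map (λ z → if eqV x z then f z else 0) (vertices n)) ≡ f x
sum-vertices-pointMass {n} (x₁ , x₂) f = begin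
  sum (map (λ z → if eqV (x₁ , x₂) z then f z else 0) (vertices n))
    ≡⟨ sum-cartesianProduct _ (allFin n) (allFin n) ⟩
  sum (map (λ a → sum (map (λ b → if eqF x₁ a ∧ eqF x₂ b then f (a , b) else 0) (allFin n))) (allFin n))
    ≡⟨ cong sum (map-cong column (allFin n)) ⟩
  sum (map (λ a → if eqF x₁ a then f (a , x₂) else 0) (allFin n))
    ≡⟨ sum-allFin-pointMass x₁ (λ a → f (a , x₂)) ⟩
  f (x₁ , x₂)
    ∎
  where
  open ≡-Reasoning
  column : ∀ a → sum (map (λ b → if eqF x₁ a ∧ eqF x₂ b then f (a , b) else 0) (allFin n))
               ≡ (if eqF x₁ a then f (a , x₂) else 0)
  column a with eqF x₁ a
  ... | true  = sum-allFin-pointMass x₂ (λ b → f (a , b))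
  ... | false = sum-map-zero (allFin n)

card-L : {n : ℕ} (i : Fin n) → card (L i) ≡ n
card-L {n} i = begin
  card (L i)
    ≡⟨ sum-cartesianProduct _ (allFin n) (allFin n) ⟩
  sum (map (λ a → sum (map (λ _ → indicator (eqF a i)) (allFin n))) (allFin n))
    ≡⟨ cong sum (map-cong row (allFin n)) ⟩
  sum (map (λ a → if eqF i a then n else 0) (allFin n))
    ≡⟨ sum-allFin-pointMass i (λ _ → n) ⟩
  n ∎
  where
  open ≡-Reasoning
  row : ∀ a → sum (map (λ _ → indicator (eqF a i)) (allFin n)) ≡ (if eqF i a then n else 0)
  row a rewrite eqF-sym a i with eqF i a
  ... | true  = trans (sum-map-one (allFin n)) (length-tabulate id)
  ... | false = sum-map-zero (allFin n)

card-∩-compl : {n : ℕ} (A S : VSet n) → card (A ∩ S) + card (A ∩ compl S) ≡ card A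
card-∩-compl {n} A S = trans (sym (sum-map-+ _ _ (vertices n))) (cong sum (map-cong split (vertices n)))
  where
  split : ∀ v → indicator (A v ∧ S v) + indicator (A v ∧ not (S v)) ≡ indicator (A v)
  split v with A v | S v
  ... | true  | true  = refl
  ... | true  | false = refl
  ... | false | _     = refl

card-∪ : {n : ℕ} (A B : VSet n) → card (A ∪ B) ≤ card A + card B
card-∪ {n} A B = ≤-trans (sum-map-mono split (vertices n)) (≤-reflexive (sum-map-+ _ _ (vertices n)))
  where
  split : ∀ v → indicator (A v ∨ B v) ≤ indicator (A v) + indicator (B v)
  split v with A v | B v
  ... | true  | _     = s≤s z≤n
  ... | false | true  = ≤-refl
  ... | false | false = z≤n

card-∅ : {n : ℕ} (A : VSet n) → (∀ v → ¬ v ∈ A) → card A ≡ 0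
card-∅ {n} A ∅ = trans (cong sum (map-cong empty (vertices n))) (sum-map-zero (vertices n))
  where
  empty : ∀ v → indicator (A v) ≡ 0
  empty v with A v in v∈A
  ... | true  = ⊥-elim (∅ v v∈A)
  ... | false = refl

rowPair-compl-column : {n : ℕ} (S : VSet n) (i i' : Fin n) (v : Vtx n) → v ∈ ((L i ∪ L i') ∩ compl S) →
  (i , proj₂ v) ∈ compl S ⊎ (i' , proj₂ v) ∈ compl S
rowPair-compl-column S i i' (a , b) v∈C with eqF a i in a≡i | eqF a i' in a≡i' | S (a , b) in a,b∉S
... | true  | _    | false = inj₁ (subst (λ k → not (S (k , b)) ≡ true) (eqF⇒≡ a≡i) (cong not a,b∉S))
... | false | true | false = inj₂ (subst (λ k → not (S (k , b)) ≡ true) (eqF⇒≡ a≡i') (cong not a,b∉S))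

vertices-complete : {n : ℕ} (x : Vtx n) → x ∈ᴸ vertices n
vertices-complete (a , b) = ∈-cartesianProduct⁺ (∈-allFin a) (∈-allFin b)

ball-1 : {n : ℕ} (x z : Vtx n) → ball 1 x z ≡ eqV x z ∨ adj x z
ball-1 {n} x z = cong (eqV x z ∨_) oneStep
  where
  oneStep : any (λ w → eqV x w ∧ adj w z) (vertices n) ≡ adj x z
  oneStep with adj x z in x~z
  ... | true  = any-witness (λ w → eqV x w ∧ adj w z) (vertices-complete x) (cong₂ _∧_ (eqV-refl x) x~z)
  ... | false = any-none (λ w → eqV x w ∧ adj w z) (vertices n) notVia
    where
    notVia : ∀ w → (eqV x w ∧ adj w z) ≡ false
    notVia w with eqV x w in x≡w
    ... | false = refl
    ... | true with refl ← eqV⇒≡ {x = x} {w} x≡w = x~z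

third : {n : ℕ} → 3 ≤ n → (p q : Fin n) → Σ (Fin n) λ c → eqF p c ≡ false × eqF c q ≡ false
third (s≤s (s≤s (s≤s _))) zero           zero           = suc zero       , refl , refl
third (s≤s (s≤s (s≤s _))) zero           (suc zero)     = suc (suc zero) , refl , refl
third (s≤s (s≤s (s≤s _))) zero           (suc (suc _))  = suc zero       , refl , refl
third (s≤s (s≤s (s≤s _))) (suc zero)     zero           = suc (suc zero) , refl , refl
third (s≤s (s≤s (s≤s _))) (suc (suc _))  zero           = suc zero       , refl , refl
third (s≤s (s≤s (s≤s _))) (suc _)        (suc _)        = zero           , refl , refl

ball-2 : {n : ℕ} → 3 ≤ n → (x z : Vtx n) → ball 2 x z ≡ true
ball-2 {n} 3≤n (a , b) (c , d) with third 3≤n a c | third 3≤n b d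
... | e , a≢e , e≢c | f , b≢f , f≢d =
  trans (cong (ball 1 (a , b) (c , d) ∨_) (any-witness _ (vertices-complete (e , f)) path)) (∨-zeroʳ _)
  where
  path : (ball 1 (a , b) (e , f) ∧ adj (e , f) (c , d)) ≡ true
  path rewrite ball-1 (a , b) (e , f) | a≢e | b≢f | e≢c | f≢d = refl

distFormula : (equal adjacent : Bool) → ℕ
distFormula true  _        = 0
distFormula false adjacent = suc (indicator (not adjacent))

dist≡distFormula : {n : ℕ} → 3 ≤ n → (x z : Vtx n) → dist x z ≡ distFormula (eqV x z) (adj x z)
dist≡distFormula 3≤n@(s≤s (s≤s (s≤s _))) x z = firstRadius (ball-1 x z) (ball-2 3≤n x z)
  where
  firstRadius : ∀ {e a b₁ b₂ r} → b₁ ≡ e ∨ a → b₂ ≡ true →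
    (if e then 0 else if b₁ then 1 else if b₂ then 2 else r) ≡ distFormula e a
  firstRadius {true}          _    _    = refl
  firstRadius {false} {true}  refl _    = refl
  firstRadius {false} {false} refl refl = refl

distFormula-≤2 : (e a : Bool) → distFormula e a ≤ 2
distFormula-≤2 true  _ = z≤n
distFormula-≤2 false a = s≤s (indicator-≤1 (not a))

absDiff-distFormula : (e a e' a' : Bool) →
  absDiff (distFormula e a) (distFormula e' a') ≤ 1 + indicator e + indicator e'
absDiff-distFormula false a false a' = absDiff-≤ (indicator-≤1 (not a)) (indicator-≤1 (not a'))
absDiff-distFormula false a true  a' = absDiff-≤ (distFormula-≤2 false a) z≤n
absDiff-distFormula true  a e'    a' = ≤-trans (absDiff-≤ z≤n (distFormula-≤2 e' a')) (s≤s (s≤s z≤n))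

module _ {n : ℕ} (3≤n : 3 ≤ n) where

  Δz≤1+[x≡z]+[y≡z] : (z x y : Vtx n) → Δz z x y ≤ 1 + indicator (eqV x z) + indicator (eqV y z)
  Δz≤1+[x≡z]+[y≡z] z x y rewrite dist≡distFormula 3≤n x z | dist≡distFormula 3≤n y z =
    absDiff-distFormula (eqV x z) (adj x z) (eqV y z) (adj y z)

  dist-offRow : {i j a b : Fin n} → eqF i a ≡ false → dist (i , j) (a , b) ≡ distFormula false (not (eqF j b))
  dist-offRow {i} {j} {a} {b} i≢a rewrite dist≡distFormula 3≤n (i , j) (a , b) | i≢a = refl

  Δz-offRows : {i i' j a b : Fin n} → eqF a i ≡ false → eqF a i' ≡ false → Δz (a , b) (i , j) (i' , j) ≡ 0
  Δz-offRows {i} {i'} {j} {a} {b} a≢i a≢i' = begin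
    absDiff (dist (i , j) (a , b)) (dist (i' , j) (a , b))
      ≡⟨ cong₂ absDiff (dist-offRow (trans (eqF-sym i a) a≢i)) (dist-offRow (trans (eqF-sym i' a) a≢i')) ⟩
    absDiff (distFormula false (not (eqF j b))) (distFormula false (not (eqF j b)))
      ≡⟨ absDiff-self (distFormula false (not (eqF j b))) ⟩
    0 ∎
    where open ≡-Reasoning

  Δz-≤-rowPair : (S : VSet n) (i i' j : Fin n) (z : Vtx n) →
    (if S z then Δz z (i , j) (i' , j) else 0)
      ≤ indicator (((L i ∪ L i') ∩ S) z)
        + (if eqV (i , j) z then indicator (S z) else 0)
        + (if eqV (i' , j) z then indicator (S z) else 0)
  Δz-≤-rowPair S i i' j z@(a , b) with S z | eqF a i in a≡i | eqF a i' in a≡i'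
  ... | false | _     | _     = z≤n
  ... | true  | false | false = ≤-trans (≤-reflexive (Δz-offRows a≡i a≡i')) z≤n
  ... | true  | true  | _     = Δz≤1+[x≡z]+[y≡z] z (i , j) (i' , j)
  ... | true  | false | true  = Δz≤1+[x≡z]+[y≡z] z (i , j) (i' , j)

  ΔS-sameColumn : (S : VSet n) (i i' j : Fin n) →
    ΔS S (i , j) (i' , j) ≤ card ((L i ∪ L i') ∩ S) + (indicator (S (i , j)) + indicator (S (i' , j)))
  ΔS-sameColumn S i i' j = begin
    ΔS S x y
      ≤⟨ sum-map-mono (Δz-≤-rowPair S i i' j) (vertices n) ⟩
    sum (map (λ z → onPair z + at x z + at y z) (vertices n))
      ≡⟨ sum-map-+ (λ z → onPair z + at x z) (at y) (vertices n) ⟩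
    sum (map (λ z → onPair z + at x z) (vertices n)) + sum (map (at y) (vertices n))
      ≡⟨ cong (_+ sum (map (at y) (vertices n))) (sum-map-+ onPair (at x) (vertices n)) ⟩
    card ((L i ∪ L i') ∩ S) + sum (map (at x) (vertices n)) + sum (map (at y) (vertices n))
      ≡⟨ cong₂ (λ p q → card ((L i ∪ L i') ∩ S) + p + q)
               (sum-vertices-pointMass x (indicator ∘ S)) (sum-vertices-pointMass y (indicator ∘ S)) ⟩
    card ((L i ∪ L i') ∩ S) + indicator (S x) + indicator (S y)
      ≡⟨ +-assoc (card ((L i ∪ L i') ∩ S)) (indicator (S x)) (indicator (S y)) ⟩
    card ((L i ∪ L i') ∩ S) + (indicator (S x) + indicator (S y))
      ∎
    where
    open ≤-Reasoning
    x y : Vtx n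
    x = i , j
    y = i' , j
    onPair : Vtx n → ℕ
    onPair z = indicator (((L i ∪ L i') ∩ S) z)
    at : Vtx n → Vtx n → ℕ
    at v z = if eqV v z then indicator (S z) else 0

  card-compl+ΔS-≤ : (S : VSet n) (i i' j : Fin n) →
    card ((L i ∪ L i') ∩ compl S) + ΔS S (i , j) (i' , j)
      ≤ 2 * n + (indicator (S (i , j)) + indicator (S (i' , j)))
  card-compl+ΔS-≤ S i i' j = begin
    c̄ + ΔS S (i , j) (i' , j)    ≤⟨ +-monoʳ-≤ c̄ (ΔS-sameColumn S i i' j) ⟩
    c̄ + (c + s)                  ≡⟨ +-assoc c̄ c s ⟨
    c̄ + c + s                    ≡⟨ cong (_+ s) (trans (+-comm c̄ c) (card-∩-compl (L i ∪ L i') S)) ⟩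
    card (L i ∪ L i') + s        ≤⟨ +-monoˡ-≤ s (card-∪ (L i) (L i')) ⟩
    card (L i) + card (L i') + s ≡⟨ cong₂ (λ p q → p + q + s) (card-L i) (card-L i') ⟩
    n + n + s                    ≡⟨ cong (λ k → n + k + s) (+-identityʳ n) ⟨
    2 * n + s                    ∎
    where
    open ≤-Reasoning
    c c̄ s : ℕ
    c = card ((L i ∪ L i') ∩ S)
    c̄ = card ((L i ∪ L i') ∩ compl S)
    s = indicator (S (i , j)) + indicator (S (i' , j))

card-rowPair-compl-≤ : {n : ℕ} (S : VSet n) (i i' : Fin n) (c : ℕ) →
  (∀ j → card ((L i ∪ L i') ∩ compl S) ≤ c + (indicator (S (i , j)) + indicator (S (i' , j)))) →
  card ((L i ∪ L i') ∩ compl S) ≤ c + 1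
card-rowPair-compl-≤ S i i' c bound
  with any? (λ j → (not (S (i , j)) ≟B true) ⊎-dec (not (S (i' , j)) ≟B true))
... | yes (j , some∉S) = ≤-trans (bound j) (+-monoʳ-≤ c (indicator+indicator-≤1 some∉S))
... | no  none∉S       = ≤-trans (≤-reflexive (card-∅ ((L i ∪ L i') ∩ compl S) noColumn)) z≤n
  where
  noColumn : ∀ v → ¬ v ∈ ((L i ∪ L i') ∩ compl S)
  noColumn v v∈C = none∉S (proj₂ v , rowPair-compl-column S i i' v v∈C)

mainTheorem10 : (n t : ℕ) → 4 ≤ n → 1 ≤ t → t ≤ n ∸ 1 → (S : VSet n)
    → WeakResolving (2 * n ∸ 2 * t ∸ 1) S
    → (i i' : Fin n) → ¬ (i ≡ i')
    → ((Σ (Fin n) λ j → ((i , j) ∈ compl S) × ((i' , j) ∈ compl S))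
         → card ((L i ∪ L i') ∩ compl S) ≤ 2 * t + 1)
      × (¬ (Σ (Fin n) λ j → ((i , j) ∈ compl S) × ((i' , j) ∈ compl S))
         → card ((L i ∪ L i') ∩ compl S) ≤ 2 * t + 2)
mainTheorem10 n t 4≤n@(s≤s _) _ t≤n∸1 S resolving i i' i≢i' = atMost2t+1 , λ _ → atMost2t+2
  -- The bound 2t + 2 holds even when some column meets S̄ in both rows.
  where
  open ≤-Reasoning
  C : ℕ
  C = card ((L i ∪ L i') ∩ compl S)
  -- The s≤s pattern makes n a successor, so t ≤ n ∸ 1 reduces and s≤s turns it into t < n.
  2t+1≤2n : 2 * t + 1 ≤ 2 * n
  2t+1≤2n = subst (_≤ 2 * n) (+-comm 1 (2 * t)) (*-monoʳ-< 2 (s≤s t≤n∸1))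
  bound : ∀ j → C ≤ 2 * t + 1 + (indicator (S (i , j)) + indicator (S (i' , j)))
  bound j = m+[n∸o]≤n+p⇒m≤o+p C _ (begin
    C + (2 * n ∸ (2 * t + 1)) ≡⟨ cong (C +_) (∸-+-assoc (2 * n) (2 * t) 1) ⟨
    C + (2 * n ∸ 2 * t ∸ 1)   ≤⟨ +-monoʳ-≤ C (resolving (i , j) (i' , j) (i≢i' ∘ cong proj₁)) ⟩
    C + ΔS S (i , j) (i' , j) ≤⟨ card-compl+ΔS-≤ (<⇒≤ 4≤n) S i i' j ⟩
    2 * n + (indicator (S (i , j)) + indicator (S (i' , j))) ∎) 2t+1≤2n
  atMost2t+1 : (Σ (Fin n) λ j → ((i , j) ∈ compl S) × ((i' , j) ∈ compl S)) → C ≤ 2 * t + 1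
  atMost2t+1 (j , x∉S , y∉S) = begin
    C
      ≤⟨ bound j ⟩
    2 * t + 1 + (indicator (S (i , j)) + indicator (S (i' , j)))
      ≡⟨ cong₂ (λ p q → 2 * t + 1 + (p + q)) (indicator-not x∉S) (indicator-not y∉S) ⟩
    2 * t + 1 + 0
      ≡⟨ +-identityʳ (2 * t + 1) ⟩
    2 * t + 1
      ∎
  atMost2t+2 : C ≤ 2 * t + 2
  atMost2t+2 = subst (C ≤_) (+-assoc (2 * t) 1 1) (card-rowPair-compl-≤ S i i' (2 * t + 1) bound)
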